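{- Let $G$ be a finite undirected graph that is prime and $P_5$-free and is not a thin spider, and let $D$ be an efficient dominating set of $G$ with exactly two vertices. Then the two vertices of $D$ can be named $d_1,d_2$ so that either $\deg(d_1)=\deg(d_2)=\delta(G)$ and $d_1,d_2$ are the only vertices of minimum degree in $G$, or $\deg(d_1)=\delta(G)$ and $d_1$ is the only vertex of minimum degree in $G$.
   Context: All graphs are finite, simple and undirected. $\deg(v)$ is the degree of $v$ and $\delta(G)$ is the minimum degree of $G$. A vertex dominates itself and its neighbors. A set $D \subseteq V(G)$ is an efficient dominating set of $G$ if every vertex of $G$ is dominated by exactly one vertex of $D$. $P_5$ denotes the chordless path on five vertices; $G$ is $P_5$-free if it has no induced subgraph isomorphic to $P_5$. A set $H$ of at least two vertices of $G$ is homogeneous if $H \neq V(G)$ and every vertex outside $H$ is adjacent either to all vertices of $H$ or to none of them; $G$ is prime if it has no homogeneous set. A thin spider is a split graph whose vertex set is partitioned into a clique $C$ and an independent set $I$ such that every vertex of $C$ has exactly one neighbor in $I$ and every vertex of $I$ has exactly one neighbor in $C$. -}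

module Defs where

open import Data.Nat using (ℕ; zero; suc; _+_; _⊓_; _≤_)
open import Data.Fin using (Fin; toℕ)
open import Data.Fin.Subset using (Subset; _∈_; _∉_; ∣_∣)
open import Data.Bool using (Bool; true; false; if_then_else_)
open import Data.List using (List; foldr; allFin)
open import Data.Product using (Σ; _×_; ∃)
open import Data.Sum using (_⊎_)
open import Relation.Nullary using (¬_)
open import Relation.Binary.PropositionalEquality using (_≡_; _≢_)
open import Function.Bundles using (_⇔_)

record Graph : Set where
  field
    n      : ℕ
    adj    : Fin n → Fin n → Bool
    sym    : ∀ u v → adj u v ≡ adj v u
    irrefl : ∀ v → adj v v ≡ false

open Graph public

Vertex : Graph → Set
Vertex G = Fin (n G)

Edge : (G : Graph) → Vertex G → Vertex G → Set
Edge G u v = adj G u v ≡ true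

countTrue : ∀ {m} → (Fin m → Bool) → ℕ
countTrue {m} p = foldr (λ i k → (if p i then 1 else 0) + k) 0 (allFin m)

deg : (G : Graph) → Vertex G → ℕ
deg G v = countTrue (adj G v)

-- minimum degree δ(G): minimum of deg over all vertices
-- (the start value n G exceeds every degree, so for a nonempty graph this is
--  exactly the minimum degree)
δ : Graph → ℕ
δ G = foldr (λ v m → deg G v ⊓ m) (n G) (allFin (n G))

Dominates : (G : Graph) → Vertex G → Vertex G → Set
Dominates G d v = d ≡ v ⊎ Edge G d v

IsEfficientDominatingSet : (G : Graph) → Subset (n G) → Set
IsEfficientDominatingSet G D =
  ∀ v → Σ (Vertex G) λ d → d ∈ D × Dominates G d v ×
        (∀ d′ → d′ ∈ D → Dominates G d′ v → d′ ≡ d)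

P5Adj : Fin 5 → Fin 5 → Set
P5Adj i j = suc (toℕ i) ≡ toℕ j ⊎ suc (toℕ j) ≡ toℕ i

HasInducedP5 : Graph → Set
HasInducedP5 G = Σ (Fin 5 → Vertex G) λ f →
  (∀ i j → f i ≡ f j → i ≡ j) × (∀ i j → Edge G (f i) (f j) ⇔ P5Adj i j)

P5Free : Graph → Set
P5Free G = ¬ HasInducedP5 G

IsHomogeneous : (G : Graph) → Subset (n G) → Set
IsHomogeneous G H =
  2 ≤ ∣ H ∣ × (∃ λ v → v ∉ H) ×
  (∀ v → v ∉ H → (∀ h → h ∈ H → Edge G v h) ⊎ (∀ h → h ∈ H → ¬ Edge G v h))

Prime : Graph → Set
Prime G = ¬ (∃ λ H → IsHomogeneous G H)

ExactlyOneNbrIn : (G : Graph) → Vertex G → (Vertex G → Set) → Set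
ExactlyOneNbrIn G v S =
  Σ (Vertex G) λ u → S u × Edge G v u × (∀ u′ → S u′ → Edge G v u′ → u′ ≡ u)

IsThinSpider : Graph → Set
IsThinSpider G = Σ (Vertex G → Bool) λ inC →
  let C = λ v → inC v ≡ true
      I = λ v → inC v ≡ false
  in (∀ u v → C u → C v → u ≢ v → Edge G u v) ×
     (∀ u v → I u → I v → ¬ Edge G u v) ×
     (∀ c → C c → ExactlyOneNbrIn G c I) ×
     (∀ i → I i → ExactlyOneNbrIn G i C)

-- Let d ∈ D and let a, a′ be non-adjacent neighbours of d. If a had a neighbour z
-- outside N[d] that a′ misses, then a′ d a z c would be an induced P₅, where c is
-- the other vertex of D dominating z. So a and a′ agree outside N[d], and the
-- neighbours of d agreeing with a outside N[d] form a homogeneous set; by primality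
-- N(d) is a clique. Likewise, if a neighbour a of d had no neighbour outside N[d],
-- then d together with all such neighbours would be homogeneous. Hence N(a) contains
-- N(d) − a, d and a vertex outside N[d], so deg a > deg d. Every vertex outside D
-- is adjacent to a vertex of D, so the minimum degree is attained only in D.

module Submission where

open import Defs hiding (sym)
open import Data.Bool using (Bool; true; false; if_then_else_)
import Data.Bool.Properties as Bool
open import Data.Empty using (⊥; ⊥-elim)
open import Data.Fin using (Fin; zero; suc; toℕ; _≟_)
open import Data.Fin.Properties using (all?; any?)
open import Data.Fin.Subset using (Subset; inside; outside; _∈_; _∉_; ∣_∣; _-_; _─_; ⁅_⁆; Nonempty)
open import Data.Fin.Subset.Properties
  using (p─⊥≡p; x∈⁅x⁆; p─q⊆p; x∈p∧x≢y⇒x∈p-y; p⊂q⇒∣p∣<∣q∣; ∣p∣≤n)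
open import Data.List using (List; []; _∷_; foldr; allFin)
import Data.List as List
open import Data.List.Membership.Propositional using () renaming (_∈_ to _∈ₗ_)
open import Data.List.Membership.Propositional.Properties using (∈-allFin)
open import Data.List.Relation.Unary.Any using (here; there)
open import Data.Nat using (ℕ; zero; suc; _+_; _⊓_; _≤_; _<_; z≤n; s≤s; s<s)
open import Data.Nat.Properties
  using (≤-refl; ≤-trans; ≤-antisym; ≤-total; <-irrefl; ≤-<-trans; <⇒≤; m⊓n≤m; m⊓n≤n; ⊓-glb;
         m≤n⇒m<n∨m≡n; suc-injective; 0≢1+n; module ≤-Reasoning)
import Data.Nat as ℕ
open import Data.Product using (Σ; ∃; _×_; _,_; proj₁; proj₂)
open import Data.Sum using (_⊎_; inj₁; inj₂; [_,_]′; swap)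
import Data.Sum as Sum
open import Data.Vec using ([]; _∷_; tabulate; lookup; here; there)
open import Data.Vec.Properties using ([]=⇒lookup; lookup⇒[]=; lookup∘tabulate)
open import Function using (_∘_; id)
open import Function.Bundles using (_⇔_; mk⇔; Equivalence)
open import Relation.Binary.PropositionalEquality using (_≡_; _≢_; refl; sym; trans; cong; subst; ≢-sym)
open import Relation.Nullary using (¬_; Dec; yes; no; does)
open import Relation.Nullary.Decidable
  using (True; False; toWitness; toWitnessFalse; dec-true; _⊎-dec_; _×-dec_; _→-dec_; ¬?; from-yes)
open import Relation.Unary using (Decidable)

≡true-ext : ∀ {b c : Bool} → (b ≡ true → c ≡ true) → (c ≡ true → b ≡ true) → b ≡ c
≡true-ext {true}  {true}  _   _   = refl
≡true-ext {false} {false} _   _   = refl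
≡true-ext {true}  {false} b⇒c _   = sym (b⇒c refl)
≡true-ext {false} {true}  _   c⇒b = c⇒b refl

x∈tabulate⁺ : ∀ {m} (p : Fin m → Bool) {x} → p x ≡ true → x ∈ tabulate p
x∈tabulate⁺ p {x} px = lookup⇒[]= x _ (trans (lookup∘tabulate p x) px)

x∈tabulate⁻ : ∀ {m} (p : Fin m → Bool) {x} → x ∈ tabulate p → p x ≡ true
x∈tabulate⁻ p {x} x∈ = trans (sym (lookup∘tabulate p x)) ([]=⇒lookup x∈)

fromDec : ∀ {m} {P : Fin m → Set} → Decidable P → Subset m
fromDec P? = tabulate (does ∘ P?)

x∈fromDec⁺ : ∀ {m} {P : Fin m → Set} (P? : Decidable P) {x} → P x → x ∈ fromDec P?
x∈fromDec⁺ P? {x} px = x∈tabulate⁺ (does ∘ P?) (dec-true (P? x) px)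

x∈fromDec⁻ : ∀ {m} {P : Fin m → Set} (P? : Decidable P) {x} → x ∈ fromDec P? → P x
x∈fromDec⁻ P? {x} x∈ with P? x | x∈tabulate⁻ (does ∘ P?) x∈
... | yes px | _ = px
... | no _   | ()

x∈p⇒∣p∣≡suc∣p-x∣ : ∀ {m} {p : Subset m} {x} → x ∈ p → ∣ p ∣ ≡ suc ∣ p - x ∣
x∈p⇒∣p∣≡suc∣p-x∣ {p = inside ∷ p}  here        = cong (suc ∘ ∣_∣) (sym (p─⊥≡p p))
x∈p⇒∣p∣≡suc∣p-x∣ {p = inside ∷ p}  (there x∈p) = cong suc (x∈p⇒∣p∣≡suc∣p-x∣ x∈p)
x∈p⇒∣p∣≡suc∣p-x∣ {p = outside ∷ p} (there x∈p) = x∈p⇒∣p∣≡suc∣p-x∣ x∈p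

x∈p─q⇒x∉q : ∀ {m} {p q : Subset m} {x} → x ∈ p ─ q → x ∉ q
x∈p─q⇒x∉q {p = _ ∷ _} (there x∈p─q) (there x∈q) = x∈p─q⇒x∉q x∈p─q x∈q
x∈p─q⇒x∉q {p = _ ∷ _} ()            here

x∈p-y⇒x≢y : ∀ {m} {p : Subset m} {x y} → x ∈ p - y → x ≢ y
x∈p-y⇒x≢y {x = x} x∈p-x refl = x∈p─q⇒x∉q x∈p-x (x∈⁅x⁆ x)

x∈p∧y∈p∧x≢y⇒2≤∣p∣ : ∀ {m} {p : Subset m} {x y} → x ∈ p → y ∈ p → x ≢ y → 2 ≤ ∣ p ∣
x∈p∧y∈p∧x≢y⇒2≤∣p∣ x∈p y∈p x≢y
  rewrite x∈p⇒∣p∣≡suc∣p-x∣ x∈p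
        | x∈p⇒∣p∣≡suc∣p-x∣ (x∈p∧x≢y⇒x∈p-y y∈p (≢-sym x≢y)) = s≤s (s≤s z≤n)

∣p∣≡suc⇒nonempty : ∀ {m k} (p : Subset m) → ∣ p ∣ ≡ suc k → Nonempty p
∣p∣≡suc⇒nonempty (inside ∷ p)  _ = zero , here
∣p∣≡suc⇒nonempty (outside ∷ p) ∣p∣≡suc with ∣p∣≡suc⇒nonempty p ∣p∣≡suc
... | x , x∈p = suc x , there x∈p

∣p∣≡1⇒singleton : ∀ {m} {p : Subset m} → ∣ p ∣ ≡ 1 → Σ (Fin m) λ x → x ∈ p × (∀ z → z ∈ p → z ≡ x)
∣p∣≡1⇒singleton {p = p} ∣p∣≡1 with ∣p∣≡suc⇒nonempty p ∣p∣≡1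
... | x , x∈p = x , x∈p , member
  where
  ∣p-x∣≡0 : ∣ p - x ∣ ≡ 0
  ∣p-x∣≡0 = suc-injective (trans (sym (x∈p⇒∣p∣≡suc∣p-x∣ x∈p)) ∣p∣≡1)
  member : ∀ z → z ∈ p → z ≡ x
  member z z∈p with z ≟ x
  ... | yes z≡x = z≡x
  ... | no z≢x  = ⊥-elim (0≢1+n (trans (sym ∣p-x∣≡0) (x∈p⇒∣p∣≡suc∣p-x∣ (x∈p∧x≢y⇒x∈p-y z∈p z≢x))))

∣p∣≡2⇒pair : ∀ {m} {p : Subset m} → ∣ p ∣ ≡ 2 →
  Σ (Fin m) λ x → Σ (Fin m) λ y → x ∈ p × y ∈ p × x ≢ y × (∀ z → z ∈ p → z ≡ x ⊎ z ≡ y)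
∣p∣≡2⇒pair {p = p} ∣p∣≡2 with ∣p∣≡suc⇒nonempty p ∣p∣≡2
... | x , x∈p with ∣p∣≡1⇒singleton (suc-injective (trans (sym (x∈p⇒∣p∣≡suc∣p-x∣ x∈p)) ∣p∣≡2))
... | y , y∈p-x , p-x⊆⁅y⁆ = x , y , x∈p , p─q⊆p p ⁅ x ⁆ y∈p-x , ≢-sym (x∈p-y⇒x≢y y∈p-x) , members
  where
  members : ∀ z → z ∈ p → z ≡ x ⊎ z ≡ y
  members z z∈p with z ≟ x
  ... | yes z≡x = inj₁ z≡x
  ... | no z≢x  = inj₂ (p-x⊆⁅y⁆ z (x∈p∧x≢y⇒x∈p-y z∈p z≢x))

countTrue-tabulate : ∀ {k m} (p : Fin k → Bool) (g : Fin m → Fin k) →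
  foldr (λ i r → (if p i then 1 else 0) + r) 0 (List.tabulate g) ≡ ∣ tabulate (p ∘ g) ∣
countTrue-tabulate {m = zero}  p g = refl
countTrue-tabulate {m = suc m} p g with p (g zero)
... | true  = cong suc (countTrue-tabulate p (g ∘ suc))
... | false = countTrue-tabulate p (g ∘ suc)

countTrue≡∣tabulate∣ : ∀ {m} (p : Fin m → Bool) → countTrue p ≡ ∣ tabulate p ∣
countTrue≡∣tabulate∣ p = countTrue-tabulate p id

foldr-⊓-≤ : ∀ {A : Set} (f : A → ℕ) z {x} {xs : List A} → x ∈ₗ xs →
  foldr (λ v m → f v ⊓ m) z xs ≤ f x
foldr-⊓-≤ f z (here refl)  = m⊓n≤m _ _
foldr-⊓-≤ f z (there x∈xs) = ≤-trans (m⊓n≤n _ _) (foldr-⊓-≤ f z x∈xs)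

≤-foldr-⊓ : ∀ {A : Set} (f : A → ℕ) {k z} (xs : List A) → k ≤ z → (∀ x → k ≤ f x) →
  k ≤ foldr (λ v m → f v ⊓ m) z xs
≤-foldr-⊓ f []       k≤z k≤f = k≤z
≤-foldr-⊓ f (x ∷ xs) k≤z k≤f = ⊓-glb (k≤f x) (≤-foldr-⊓ f xs k≤z k≤f)

OnlyMinimisers : {A : Set} → (A → ℕ) → ℕ → A → A → Set
OnlyMinimisers f m x y =
  (f x ≡ m × f y ≡ m × (∀ v → f v ≡ m → v ≡ x ⊎ v ≡ y)) ⊎ (f x ≡ m × (∀ v → f v ≡ m → v ≡ x))

only-minimisers : ∀ {A : Set} {f : A → ℕ} {m x y} → f x ≡ m → f x ≤ f y →
  (∀ v → v ≡ x ⊎ v ≡ y ⊎ f x < f v) → OnlyMinimisers f m x y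
only-minimisers {f = f} {m} {x} {y} fx≡m fx≤fy above = [ strict , tie ]′ (m≤n⇒m<n∨m≡n fx≤fy)
  where
  ¬above : ∀ {v} → f v ≡ m → ¬ f x < f v
  ¬above fv≡m = <-irrefl (trans fx≡m (sym fv≡m))
  within : ∀ {v} → f v ≡ m → v ≡ x ⊎ v ≡ y
  within {v} fv≡m = [ inj₁ , [ inj₂ , ⊥-elim ∘ ¬above fv≡m ]′ ]′ (above v)
  strict : f x < f y → OnlyMinimisers f m x y
  strict fx<fy = inj₂ (fx≡m , λ v fv≡m →
    [ id , (λ { refl → ⊥-elim (¬above fv≡m fx<fy) }) ]′ (within fv≡m))
  tie : f x ≡ f y → OnlyMinimisers f m x y
  tie fx≡fy = inj₁ (fx≡m , trans (sym fx≡fy) fx≡m , λ v → within)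

P5Adj? : ∀ i j → Dec (P5Adj i j)
P5Adj? i j = (suc (toℕ i) ℕ.≟ toℕ j) ⊎-dec (suc (toℕ j) ℕ.≟ toℕ i)

P5-twin-free : ∀ i j → (∀ k → (P5Adj i k → P5Adj j k) × (P5Adj j k → P5Adj i k)) → i ≡ j
P5-twin-free = from-yes (all? λ i → all? λ j →
  all? (λ k → (P5Adj? i k →-dec P5Adj? j k) ×-dec (P5Adj? j k →-dec P5Adj? i k)) →-dec (i ≟ j))

pattern f0 = zero
pattern f1 = suc f0
pattern f2 = suc f1
pattern f3 = suc f2
pattern f4 = suc f3

module GraphProperties (G : Graph) where

  edge-sym : ∀ {u v} → Edge G u v → Edge G v u
  edge-sym {u} {v} e = trans (Graph.sym G v u) e

  loopless : ∀ {v} → ¬ Edge G v v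
  loopless {v} e with trans (sym e) (irrefl G v)
  ... | ()

  Edge⇒≢ : ∀ {u v} → Edge G u v → u ≢ v
  Edge⇒≢ e refl = loopless e

  Edge? : ∀ u v → Dec (Edge G u v)
  Edge? u v = adj G u v Bool.≟ true

  Dominates? : ∀ d v → Dec (Dominates G d v)
  Dominates? d v = (d ≟ v) ⊎-dec Edge? d v

  N : Vertex G → Subset (n G)
  N v = tabulate (adj G v)

  deg≡∣N∣ : ∀ v → deg G v ≡ ∣ N v ∣
  deg≡∣N∣ v = countTrue≡∣tabulate∣ (adj G v)

  δ≤deg : ∀ v → δ G ≤ deg G v
  δ≤deg v = foldr-⊓-≤ (deg G) (n G) (∈-allFin v)

  ≤δ : ∀ {k} → k ≤ n G → (∀ v → k ≤ deg G v) → k ≤ δ G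
  ≤δ k≤n = ≤-foldr-⊓ (deg G) (allFin (n G)) k≤n

  deg≤n : ∀ v → deg G v ≤ n G
  deg≤n v = subst (_≤ n G) (sym (deg≡∣N∣ v)) (∣p∣≤n (N v))

  prime⇒¬homogeneous : Prime G → ∀ {P : Vertex G → Set} (P? : Decidable P) {x y w} →
    P x → P y → x ≢ y → ¬ P w →
    (∀ v → ¬ P v → (∀ h → P h → Edge G v h) ⊎ (∀ h → P h → ¬ Edge G v h)) → ⊥
  prime⇒¬homogeneous prime P? {w = w} px py x≢y ¬pw homogeneous =
    prime (fromDec P? , x∈p∧y∈p∧x≢y⇒2≤∣p∣ (x∈fromDec⁺ P? px) (x∈fromDec⁺ P? py) x≢y
                      , (w , ¬pw ∘ x∈fromDec⁻ P?)
                      , λ v v∉ → Sum.map (λ all h → all h ∘ x∈fromDec⁻ P?)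
                                         (λ none h → none h ∘ x∈fromDec⁻ P?)
                                         (homogeneous v (v∉ ∘ x∈fromDec⁺ P?)))

  deg-<-by-neighbourhood-inclusion : ∀ {d a b} → Edge G d a → (∀ x → Edge G d x → x ≢ a → Edge G a x) →
    Edge G a b → ¬ Dominates G d b → deg G d < deg G a
  deg-<-by-neighbourhood-inclusion {d} {a} {b} da clique ab ¬db = begin-strict
    deg G d          ≡⟨ deg≡∣N∣ d ⟩
    ∣ N d ∣          ≡⟨ x∈p⇒∣p∣≡suc∣p-x∣ (x∈tabulate⁺ (adj G d) da) ⟩
    suc ∣ N d - a ∣  <⟨ s<s (p⊂q⇒∣p∣<∣q∣ (Nd-a⊆Na-b , d , d∈Na-b , d∉Nd-a)) ⟩
    suc ∣ N a - b ∣  ≡⟨ sym (x∈p⇒∣p∣≡suc∣p-x∣ (x∈tabulate⁺ (adj G a) ab)) ⟩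
    ∣ N a ∣          ≡⟨ sym (deg≡∣N∣ a) ⟩
    deg G a          ∎
    where
    open ≤-Reasoning
    Nd-a⊆Na-b : ∀ {x} → x ∈ N d - a → x ∈ N a - b
    Nd-a⊆Na-b {x} x∈ =
      x∈p∧x≢y⇒x∈p-y (x∈tabulate⁺ (adj G a) (clique x dx (x∈p-y⇒x≢y x∈))) λ { refl → ¬db (inj₂ dx) }
      where
      dx : Edge G d x
      dx = x∈tabulate⁻ (adj G d) (p─q⊆p (N d) ⁅ a ⁆ x∈)
    d∈Na-b : d ∈ N a - b
    d∈Na-b = x∈p∧x≢y⇒x∈p-y (x∈tabulate⁺ (adj G a) (edge-sym da)) (¬db ∘ inj₁)
    d∉Nd-a : d ∉ N d - a
    d∉Nd-a = loopless ∘ x∈tabulate⁻ (adj G d) ∘ p─q⊆p (N d) ⁅ a ⁆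

  induced-P5 : ∀ {v₀ v₁ v₂ v₃ v₄} →
    Edge G v₀ v₁ → Edge G v₁ v₂ → Edge G v₂ v₃ → Edge G v₃ v₄ →
    ¬ Edge G v₀ v₂ → ¬ Edge G v₀ v₃ → ¬ Edge G v₀ v₄ →
    ¬ Edge G v₁ v₃ → ¬ Edge G v₁ v₄ → ¬ Edge G v₂ v₄ → HasInducedP5 G
  induced-P5 {v₀} {v₁} {v₂} {v₃} {v₄} e₀₁ e₁₂ e₂₃ e₃₄ n₀₂ n₀₃ n₀₄ n₁₃ n₁₄ n₂₄ =
    path , injective , path-edges
    where
    path : Fin 5 → Vertex G
    path = lookup (v₀ ∷ v₁ ∷ v₂ ∷ v₃ ∷ v₄ ∷ [])

    PathEdge : Fin 5 → Fin 5 → Set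
    PathEdge i j = Edge G (path i) (path j) ⇔ P5Adj i j

    edge : ∀ {i j} → Edge G (path i) (path j) → {True (P5Adj? i j)} → PathEdge i j
    edge e {adjacent} = mk⇔ (λ _ → toWitness adjacent) (λ _ → e)

    non : ∀ {i j} → ¬ Edge G (path i) (path j) → {False (P5Adj? i j)} → PathEdge i j
    non ne {nonadjacent} = mk⇔ (⊥-elim ∘ ne) (⊥-elim ∘ toWitnessFalse nonadjacent)

    mirror : ∀ {i j} → PathEdge i j → PathEdge j i
    mirror e = mk⇔ (swap ∘ Equivalence.to e ∘ edge-sym) (edge-sym ∘ Equivalence.from e ∘ swap)

    path-edges : ∀ i j → PathEdge i j
    path-edges f0 f0 = non loopless
    path-edges f0 f1 = edge e₀₁
    path-edges f0 f2 = non n₀₂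
    path-edges f0 f3 = non n₀₃
    path-edges f0 f4 = non n₀₄
    path-edges f1 f1 = non loopless
    path-edges f1 f2 = edge e₁₂
    path-edges f1 f3 = non n₁₃
    path-edges f1 f4 = non n₁₄
    path-edges f2 f2 = non loopless
    path-edges f2 f3 = edge e₂₃
    path-edges f2 f4 = non n₂₄
    path-edges f3 f3 = non loopless
    path-edges f3 f4 = edge e₃₄
    path-edges f4 f4 = non loopless
    path-edges f1 f0 = mirror (path-edges f0 f1)
    path-edges f2 f0 = mirror (path-edges f0 f2)
    path-edges f2 f1 = mirror (path-edges f1 f2)
    path-edges f3 f0 = mirror (path-edges f0 f3)
    path-edges f3 f1 = mirror (path-edges f1 f3)
    path-edges f3 f2 = mirror (path-edges f2 f3)
    path-edges f4 f0 = mirror (path-edges f0 f4)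
    path-edges f4 f1 = mirror (path-edges f1 f4)
    path-edges f4 f2 = mirror (path-edges f2 f4)
    path-edges f4 f3 = mirror (path-edges f3 f4)

    transfer : ∀ {i j} → path i ≡ path j → ∀ k → P5Adj i k → P5Adj j k
    transfer {i} {j} eq k =
      Equivalence.to (path-edges j k) ∘ subst (λ w → Edge G w (path k)) eq
      ∘ Equivalence.from (path-edges i k)

    injective : ∀ i j → path i ≡ path j → i ≡ j
    injective i j eq = P5-twin-free i j λ k → transfer eq k , transfer (sym eq) k

module EfficientDomination (G : Graph) (D : Subset (n G)) (efficient : IsEfficientDominatingSet G D)
                           (prime : Prime G) (p5-free : P5Free G) where
  open GraphProperties G

  dominator-unique : ∀ {d d′ v} → d ∈ D → d′ ∈ D → Dominates G d v → Dominates G d′ v → d ≡ d′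
  dominator-unique {v = v} d∈D d′∈D dom dom′ with efficient v
  ... | _ , _ , _ , unique = trans (unique _ d∈D dom) (sym (unique _ d′∈D dom′))

  nonadjacent-neighbours-agree-outside : ∀ {d a a′ z} → d ∈ D → Edge G d a → Edge G d a′ →
    ¬ Edge G a a′ → ¬ Dominates G d z → Edge G a z → Edge G a′ z
  nonadjacent-neighbours-agree-outside {d} {a} {a′} {z} d∈D da da′ ¬aa′ ¬dz az
    with Edge? a′ z | efficient z
  ... | yes a′z | _ = a′z
  ... | no ¬a′z | c , c∈D , cz , _ =
    ⊥-elim (p5-free (induced-P5 (edge-sym da′) da az (edge-sym c~z)
                                (¬aa′ ∘ edge-sym) ¬a′z (¬adjacent-c da′) (¬dz ∘ inj₂)
                                (λ dc → d≢c (dominator-unique d∈D c∈D (inj₂ dc) (inj₁ refl)))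
                                (¬adjacent-c da)))
    where
    d≢c : d ≢ c
    d≢c refl = ¬dz cz
    ¬adjacent-c : ∀ {x} → Edge G d x → ¬ Edge G x c
    ¬adjacent-c dx xc = d≢c (dominator-unique d∈D c∈D (inj₂ dx) (inj₂ (edge-sym xc)))
    c~z : Edge G c z
    c~z = [ (λ { refl → ⊥-elim (¬adjacent-c da az) }) , id ]′ cz

  nonadjacent-neighbours-same-outside : ∀ {d x y} → d ∈ D → Edge G d x → Edge G d y → ¬ Edge G x y →
    ∀ z → ¬ Dominates G d z → adj G x z ≡ adj G y z
  nonadjacent-neighbours-same-outside d∈D dx dy ¬xy z ¬dz =
    ≡true-ext (nonadjacent-neighbours-agree-outside d∈D dx dy ¬xy ¬dz)
              (nonadjacent-neighbours-agree-outside d∈D dy dx (¬xy ∘ edge-sym) ¬dz)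

  neighbourhood-clique : ∀ {d a a′} → d ∈ D → Edge G d a → Edge G d a′ → a ≢ a′ → Edge G a a′
  neighbourhood-clique {d} {a} {a′} d∈D da da′ a≢a′ with Edge? a a′
  ... | yes aa′ = aa′
  ... | no ¬aa′ =
    ⊥-elim (prime⇒¬homogeneous prime P? (da , λ _ _ → refl)
             (da′ , λ z ¬dz → sym (nonadjacent-neighbours-same-outside d∈D da da′ ¬aa′ z ¬dz))
             a≢a′ (loopless ∘ proj₁) homogeneous)
    where
    P : Vertex G → Set
    P x = Edge G d x × (∀ z → ¬ Dominates G d z → adj G x z ≡ adj G a z)
    P? : Decidable P
    P? x = Edge? d x ×-dec all? λ z → ¬? (Dominates? d z) →-dec (adj G x z Bool.≟ adj G a z)
    homogeneous : ∀ v → ¬ P v → (∀ h → P h → Edge G v h) ⊎ (∀ h → P h → ¬ Edge G v h)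
    homogeneous v ¬pv with Dominates? d v
    ... | yes (inj₁ refl) = inj₁ λ h → proj₁
    ... | yes (inj₂ dv) = inj₁ adjacent
      where
      adjacent : ∀ h → P h → Edge G v h
      adjacent h (dh , h~a) with Edge? v h
      ... | yes vh = vh
      ... | no ¬vh = ⊥-elim (¬pv (dv , λ z ¬dz →
                       trans (nonadjacent-neighbours-same-outside d∈D dv dh ¬vh z ¬dz) (h~a z ¬dz)))
    ... | no ¬dv with Edge? a v
    ... | yes av = inj₁ λ h ph → trans (Graph.sym G v h) (trans (proj₂ ph v ¬dv) av)
    ... | no ¬av = inj₂ λ h ph vh → ¬av (trans (sym (proj₂ ph v ¬dv)) (trans (Graph.sym G h v) vh))

  neighbour-with-undominated-neighbour : ∀ {d a w} → d ∈ D → ¬ Dominates G d w → Edge G d a →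
    ∃ λ b → Edge G a b × ¬ Dominates G d b
  neighbour-with-undominated-neighbour {d} {a} {w} d∈D ¬dw da
    with any? (λ b → Edge? a b ×-dec ¬? (Dominates? d b))
  ... | yes found = found
  ... | no none =
    ⊥-elim (prime⇒¬homogeneous prime Q? (inj₁ refl) (inj₂ (da , λ z ¬dz az → none (z , az , ¬dz)))
             (Edge⇒≢ da) ¬qw homogeneous)
    where
    Q : Vertex G → Set
    Q x = x ≡ d ⊎ (Edge G d x × (∀ z → ¬ Dominates G d z → ¬ Edge G x z))
    Q? : Decidable Q
    Q? x = (x ≟ d) ⊎-dec (Edge? d x ×-dec all? λ z → ¬? (Dominates? d z) →-dec ¬? (Edge? x z))
    ¬qw : ¬ Q w
    ¬qw (inj₁ refl)      = ¬dw (inj₁ refl)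
    ¬qw (inj₂ (dw , _))  = ¬dw (inj₂ dw)
    homogeneous : ∀ v → ¬ Q v → (∀ h → Q h → Edge G v h) ⊎ (∀ h → Q h → ¬ Edge G v h)
    homogeneous v ¬qv with Dominates? d v
    ... | yes (inj₁ refl) = ⊥-elim (¬qv (inj₁ refl))
    ... | yes (inj₂ dv) = inj₁ adjacent
      where
      adjacent : ∀ h → Q h → Edge G v h
      adjacent h (inj₁ refl) = edge-sym dv
      adjacent h (inj₂ qh) = neighbourhood-clique d∈D dv (proj₁ qh) λ { refl → ¬qv (inj₂ qh) }
    ... | no ¬dv = inj₂ nonadjacent
      where
      nonadjacent : ∀ h → Q h → ¬ Edge G v h
      nonadjacent h (inj₁ refl) vd = ¬dv (inj₂ (edge-sym vd))
      nonadjacent h (inj₂ (_ , h-out)) vh = h-out v ¬dv (edge-sym vh)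

  deg-<-of-neighbour : ∀ {d a w} → d ∈ D → ¬ Dominates G d w → Edge G d a → deg G d < deg G a
  deg-<-of-neighbour d∈D ¬dw da with neighbour-with-undominated-neighbour d∈D ¬dw da
  ... | b , ab , ¬db =
    deg-<-by-neighbourhood-inclusion da (λ x dx x≢a → neighbourhood-clique d∈D da dx (≢-sym x≢a)) ab ¬db

  ¬dominates-other-member : ∀ {d d′} → d ∈ D → d′ ∈ D → d ≢ d′ → ¬ Dominates G d d′
  ¬dominates-other-member d∈D d′∈D d≢d′ dom = d≢d′ (dominator-unique d∈D d′∈D dom (inj₁ refl))

  only-minimisers-in-pair : ∀ {d₁ d₂} → d₁ ∈ D → d₂ ∈ D → d₁ ≢ d₂ → (∀ v → v ∈ D → v ≡ d₁ ⊎ v ≡ d₂) →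
    deg G d₁ ≤ deg G d₂ → OnlyMinimisers (deg G) (δ G) d₁ d₂
  only-minimisers-in-pair {d₁} {d₂} d₁∈D d₂∈D d₁≢d₂ D⊆ d₁≤d₂ =
    only-minimisers (≤-antisym (≤δ (deg≤n d₁) d₁-minimal) (δ≤deg d₁)) d₁≤d₂ above
    where
    undominated : ∀ {c} → c ∈ D → ∃ λ w → ¬ Dominates G c w
    undominated c∈D with D⊆ _ c∈D
    ... | inj₁ refl = d₂ , ¬dominates-other-member d₁∈D d₂∈D d₁≢d₂
    ... | inj₂ refl = d₁ , ¬dominates-other-member d₂∈D d₁∈D (≢-sym d₁≢d₂)
    d₁-minimal-in-D : ∀ {c} → c ∈ D → deg G d₁ ≤ deg G c
    d₁-minimal-in-D c∈D = [ (λ { refl → ≤-refl }) , (λ { refl → d₁≤d₂ }) ]′ (D⊆ _ c∈D)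
    above : ∀ v → v ≡ d₁ ⊎ v ≡ d₂ ⊎ deg G d₁ < deg G v
    above v with efficient v
    ... | c , c∈D , inj₁ refl , _ = Sum.map₂ inj₁ (D⊆ c c∈D)
    ... | c , c∈D , inj₂ cv , _ =
      inj₂ (inj₂ (≤-<-trans (d₁-minimal-in-D c∈D)
                            (deg-<-of-neighbour c∈D (proj₂ (undominated c∈D)) cv)))
    d₁-minimal : ∀ v → deg G d₁ ≤ deg G v
    d₁-minimal v = [ (λ { refl → ≤-refl }) , [ (λ { refl → d₁≤d₂ }) , <⇒≤ ]′ ]′ (above v)

lemma2 : (G : Graph) → Prime G → P5Free G → ¬ IsThinSpider G →
    (D : Subset (n G)) → IsEfficientDominatingSet G D → ∣ D ∣ ≡ 2 →
    Σ (Vertex G) λ d₁ → Σ (Vertex G) λ d₂ →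
      d₁ ∈ D × d₂ ∈ D × d₁ ≢ d₂ ×
      ((deg G d₁ ≡ δ G × deg G d₂ ≡ δ G ×
          (∀ v → deg G v ≡ δ G → v ≡ d₁ ⊎ v ≡ d₂))
       ⊎
       (deg G d₁ ≡ δ G × (∀ v → deg G v ≡ δ G → v ≡ d₁)))
lemma2 G prime p5-free _ D efficient ∣D∣≡2 =
  let d , d′ , d∈D , d′∈D , d≢d′ , D⊆ = ∣p∣≡2⇒pair ∣D∣≡2
  in [ (λ d≤d′ → d , d′ , d∈D , d′∈D , d≢d′ , only-minimisers-in-pair d∈D d′∈D d≢d′ D⊆ d≤d′)
     , (λ d′≤d → d′ , d , d′∈D , d∈D , ≢-sym d≢d′ ,
                 only-minimisers-in-pair d′∈D d∈D (≢-sym d≢d′) (λ v → swap ∘ D⊆ v) d′≤d)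
     ]′ (≤-total (deg G d) (deg G d′))
  where open EfficientDomination G D efficient prime p5-free
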